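{- Let $m\ge 3$ be an odd integer. Then for every $n\ge 0$, \[ p_m(n,-1)=(-1)^n p_m(n,1). \] In particular $|p_m(n,-1)|\to\infty$ as $n\to\infty$, and $p_m(n,-1)\neq 0$ for all $n$.
   Context: The $m$-ary partition polynomials $p_m(n,t)$ are defined by the power series expansion $\prod_{j=0}^{\infty}\frac{1}{1-tq^{m^j}}=\sum_{n=0}^{\infty}p_m(n,t)q^n$; in particular $p_m(n,1)$ is the number of partitions of $n$ into powers of $m$. -}

module Defs where

open import Data.Nat as ℕ using (ℕ; zero; suc; _≤?_)
open import Data.Integer using (ℤ; +_; _+_; _*_; _^_)
open import Data.List using (List; []; _∷_; map; upTo)
open import Relation.Nullary using (yes; no)

sumTo : ℕ → (ℕ → ℤ) → ℤ
sumTo zero    f = f 0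
sumTo (suc n) f = sumTo n f + f (suc n)

-- Coefficient of q^n in  ∏_{a ∈ L} 1/(1 - t q^a)
-- (parts of L are assumed positive; each may be used any number of times),
-- i.e. Σ over partitions of n with parts in L of t^(number of parts).
coeffProd : ℤ → List ℕ → ℕ → ℤ
coeffProd t []      zero    = + 1
coeffProd t []      (suc n) = + 0
coeffProd t (a ∷ L) n =
  sumTo n (λ k → term k)
  where
  term : ℕ → ℤ
  term k with k ℕ.* a ≤? n
  ... | yes _ = (t ^ k) * coeffProd t L (n ℕ.∸ k ℕ.* a)
  ... | no  _ = + 0

-- m-ary partition polynomial p_m(n,t): coefficient of q^n in
-- ∏_{j ≥ 0} 1/(1 - t q^{m^j}).  For m ≥ 2 only the factors with
-- m^j ≤ n (hence j < n+1) affect the q^n coefficient, the others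
-- contribute 1 + O(q^{n+1}); so we truncate the product to j = 0..n.
p : ℕ → ℕ → ℤ → ℤ
p m n t = coeffProd t (map (m ℕ.^_) (upTo (suc n))) n

{-# OPTIONS --safe #-}
module Submission where

-- All parts m ^ j are odd, so a partition of n into k such parts has k ≡ n (mod 2); hence
-- replacing t by -t multiplies the coefficient of q ^ n by (-1) ^ n. As all coefficients at
-- t = 1 are nonnegative, p m n 1 is at least the number of partitions of n into parts 1 and m,
-- which is ⌊n/m⌋ + 1; so it is positive and unbounded.

open import Defs
open import Data.Nat using (ℕ; _≥_; _<_)
open import Data.Nat.DivMod using (_%_)
open import Data.Integer using (ℤ; -_; +_; _^_; _*_; ∣_∣)
open import Data.Product using (_×_; ∃-syntax)
open import Relation.Binary.PropositionalEquality using (_≡_; _≢_)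

open import Data.Nat as ℕ using (zero; suc; _≤?_; z≤n; s≤s; NonZero)
import Data.Nat.Properties as ℕ
open import Data.Nat.DivMod using (_/_; m≡m%n+[m/n]*n; %-distribˡ-*)
open import Data.Integer using (_+_; _≤_; 0ℤ; 1ℤ; -1ℤ; +≤+)
open import Data.Integer.Properties
  using (*-identityˡ; *-zeroʳ; *-distribˡ-+; +-assoc; ^-zeroˡ; ^-*-assoc; ^-distribˡ-+-*;
         -1*i≡-i; ∣-i∣≡∣i∣; abs-*; ≤-refl; ≤-reflexive; ≤-trans; i≤j+i; i≤i+j; +-mono-≤;
         *-commutativeSemigroup; module ≤-Reasoning)
open import Data.Integer.Base using (nonNegative)
open import Algebra.Properties.CommutativeSemigroup *-commutativeSemigroup using (interchange)
open import Data.List using (List; []; _∷_; map; upTo; applyUpTo)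
open import Data.List.Relation.Unary.All using (All; []; _∷_; universal)
open import Data.List.Relation.Unary.All.Properties using (map⁺)
open import Data.Product using (_,_)
open import Data.Sum using (inj₁; inj₂)
open import Data.Empty using (⊥-elim)
open import Function using (_∘_)
open import Relation.Nullary using (yes; no)
open import Relation.Binary.PropositionalEquality using (refl; sym; trans; cong; cong₂; subst; module ≡-Reasoning)

Odd : ℕ → Set
Odd a = a % 2 ≡ 1

odd-* : ∀ a b → Odd a → Odd b → Odd (a ℕ.* b)
odd-* a b oa ob = trans (%-distribˡ-* a b 2) (cong₂ (λ x y → (x ℕ.* y) % 2) oa ob)

odd-^ : ∀ m → Odd m → ∀ j → Odd (m ℕ.^ j)
odd-^ m om zero    = refl
odd-^ m om (suc j) = odd-* m (m ℕ.^ j) om (odd-^ m om j)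

-1^odd : ∀ a → Odd a → -1ℤ ^ a ≡ -1ℤ
-1^odd a oa = begin
  -1ℤ ^ a                       ≡⟨ cong (-1ℤ ^_) (trans (m≡m%n+[m/n]*n a 2) (cong (ℕ._+ q ℕ.* 2) oa)) ⟩
  -1ℤ * -1ℤ ^ (q ℕ.* 2)         ≡⟨ cong (λ e → -1ℤ * -1ℤ ^ e) (ℕ.*-comm q 2) ⟩
  -1ℤ * -1ℤ ^ (2 ℕ.* q)         ≡⟨ cong (-1ℤ *_) (sym (^-*-assoc -1ℤ 2 q)) ⟩
  -1ℤ * 1ℤ ^ q                  ≡⟨ cong (-1ℤ *_) (^-zeroˡ q) ⟩
  -1ℤ                           ∎
  where open ≡-Reasoning; q = a / 2

-1^-*odd : ∀ k a → Odd a → -1ℤ ^ (k ℕ.* a) ≡ -1ℤ ^ k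
-1^-*odd k a oa = begin
  -1ℤ ^ (k ℕ.* a)   ≡⟨ cong (-1ℤ ^_) (ℕ.*-comm k a) ⟩
  -1ℤ ^ (a ℕ.* k)   ≡⟨ sym (^-*-assoc -1ℤ a k) ⟩
  (-1ℤ ^ a) ^ k     ≡⟨ cong (_^ k) (-1^odd a oa) ⟩
  -1ℤ ^ k           ∎
  where open ≡-Reasoning

^-neg : ∀ t k → (- t) ^ k ≡ -1ℤ ^ k * t ^ k
^-neg t zero    = refl
^-neg t (suc k) = begin
  - t * (- t) ^ k                ≡⟨ cong₂ _*_ (sym (-1*i≡-i t)) (^-neg t k) ⟩
  -1ℤ * t * (-1ℤ ^ k * t ^ k)   ≡⟨ interchange -1ℤ t (-1ℤ ^ k) (t ^ k) ⟩
  -1ℤ * -1ℤ ^ k * (t * t ^ k)   ∎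
  where open ≡-Reasoning

∣-1^n*i∣≡∣i∣ : ∀ n i → ∣ -1ℤ ^ n * i ∣ ≡ ∣ i ∣
∣-1^n*i∣≡∣i∣ n i = begin
  ∣ -1ℤ ^ n * i ∣         ≡⟨ abs-* (-1ℤ ^ n) i ⟩
  ∣ -1ℤ ^ n ∣ ℕ.* ∣ i ∣   ≡⟨ cong (ℕ._* ∣ i ∣) (∣-1^n∣≡1 n) ⟩
  1 ℕ.* ∣ i ∣             ≡⟨ ℕ.*-identityˡ ∣ i ∣ ⟩
  ∣ i ∣                   ∎
  where
  open ≡-Reasoning
  ∣-1^n∣≡1 : ∀ n → ∣ -1ℤ ^ n ∣ ≡ 1
  ∣-1^n∣≡1 zero    = refl
  ∣-1^n∣≡1 (suc n) = trans (cong ∣_∣ (-1*i≡-i (-1ℤ ^ n))) (trans (∣-i∣≡∣i∣ (-1ℤ ^ n)) (∣-1^n∣≡1 n))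

+≤⇒≤∣∣ : ∀ {k i} → + k ≤ i → k ℕ.≤ ∣ i ∣
+≤⇒≤∣∣ (+≤+ k≤n) = k≤n

mono-from-suc : (f : ℕ → ℤ) → (∀ n → f n ≤ f (suc n)) → ∀ {j n} → j ℕ.≤ n → f j ≤ f n
mono-from-suc f step {zero}  {zero}  _         = ≤-refl
mono-from-suc f step {zero}  {suc n} _         = ≤-trans (mono-from-suc f step {0} {n} z≤n) (step n)
mono-from-suc f step {suc j} {suc n} (s≤s j≤n) = mono-from-suc (f ∘ suc) (step ∘ suc) j≤n

sumTo-cong : ∀ n {f g : ℕ → ℤ} → (∀ k → k ℕ.≤ n → f k ≡ g k) → sumTo n f ≡ sumTo n g
sumTo-cong zero    eq = eq 0 z≤n
sumTo-cong (suc n) eq = cong₂ _+_ (sumTo-cong n (λ k k≤n → eq k (ℕ.m≤n⇒m≤1+n k≤n))) (eq (suc n) ℕ.≤-refl)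

sumTo-*ˡ : ∀ n c (f : ℕ → ℤ) → sumTo n (λ k → c * f k) ≡ c * sumTo n f
sumTo-*ˡ zero    c f = refl
sumTo-*ˡ (suc n) c f = trans (cong (_+ c * f (suc n)) (sumTo-*ˡ n c f))
                             (sym (*-distribˡ-+ c (sumTo n f) (f (suc n))))

sumTo-sucˡ : ∀ n (f : ℕ → ℤ) → sumTo (suc n) f ≡ f 0 + sumTo n (f ∘ suc)
sumTo-sucˡ zero    f = refl
sumTo-sucˡ (suc n) f = trans (cong (_+ f (suc (suc n))) (sumTo-sucˡ n f)) (+-assoc (f 0) _ _)

sumTo-nonneg : ∀ n {f : ℕ → ℤ} → (∀ k → 0ℤ ≤ f k) → 0ℤ ≤ sumTo n f
sumTo-nonneg zero    f≥0 = f≥0 0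
sumTo-nonneg (suc n) f≥0 = +-mono-≤ (sumTo-nonneg n f≥0) (f≥0 (suc n))

term≤sumTo : ∀ n {f : ℕ → ℤ} → (∀ k → 0ℤ ≤ f k) → ∀ {i} → i ℕ.≤ n → f i ≤ sumTo n f
term≤sumTo zero    f≥0 z≤n = ≤-refl
term≤sumTo (suc n) {f} f≥0 {i} i≤1+n with ℕ.m≤n⇒m<n∨m≡n i≤1+n
... | inj₁ (s≤s i≤n) = ≤-trans (term≤sumTo n f≥0 i≤n) (i≤i+j _ _ ⦃ nonNegative (f≥0 (suc n)) ⦄)
... | inj₂ refl      = i≤j+i _ _ ⦃ nonNegative (sumTo-nonneg n f≥0) ⦄

summand : ℤ → ℕ → List ℕ → ℕ → ℕ → ℤ
summand t a L n k with k ℕ.* a ≤? n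
... | yes _ = t ^ k * coeffProd t L (n ℕ.∸ k ℕ.* a)
... | no  _ = 0ℤ

-- `summand` copies the local function `term` of Defs.coeffProd, which cannot be named here;
-- the left-hand side of `term≡summand` is found by unification, hence the mutual block.
mutual
  coeffProd-∷ : ∀ t a L n → coeffProd t (a ∷ L) n ≡ sumTo n (summand t a L n)
  coeffProd-∷ t a L n = sumTo-cong n (λ k _ → term≡summand t a L n k)

  term≡summand : ∀ t a L n k → _ ≡ summand t a L n k
  term≡summand t a L n k with k ℕ.* a ≤? n
  ... | yes _ = refl
  ... | no  _ = refl

summand-≤ : ∀ t a L n k → k ℕ.* a ℕ.≤ n → summand t a L n k ≡ t ^ k * coeffProd t L (n ℕ.∸ k ℕ.* a)
summand-≤ t a L n k ka≤n with k ℕ.* a ≤? n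
... | yes _   = refl
... | no ka≰n = ⊥-elim (ka≰n ka≤n)

-1^k*-1^[n∸ka]≡-1^n : ∀ n k a → Odd a → k ℕ.* a ℕ.≤ n → -1ℤ ^ k * -1ℤ ^ (n ℕ.∸ k ℕ.* a) ≡ -1ℤ ^ n
-1^k*-1^[n∸ka]≡-1^n n k a oa ka≤n = begin
  -1ℤ ^ k * -1ℤ ^ (n ℕ.∸ k ℕ.* a)             ≡⟨ cong (_* -1ℤ ^ (n ℕ.∸ k ℕ.* a)) (sym (-1^-*odd k a oa)) ⟩
  -1ℤ ^ (k ℕ.* a) * -1ℤ ^ (n ℕ.∸ k ℕ.* a)     ≡⟨ sym (^-distribˡ-+-* -1ℤ (k ℕ.* a) _) ⟩
  -1ℤ ^ (k ℕ.* a ℕ.+ (n ℕ.∸ k ℕ.* a))         ≡⟨ cong (-1ℤ ^_) (ℕ.m+[n∸m]≡n ka≤n) ⟩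
  -1ℤ ^ n                                     ∎
  where open ≡-Reasoning

coeffProd-neg : ∀ t L → All Odd L → ∀ n → coeffProd (- t) L n ≡ -1ℤ ^ n * coeffProd t L n
coeffProd-neg t []      []          zero    = refl
coeffProd-neg t []      []          (suc n) = sym (*-zeroʳ (-1ℤ ^ suc n))
coeffProd-neg t (a ∷ L) (oa ∷ oddL) n = begin
  coeffProd (- t) (a ∷ L) n                        ≡⟨ coeffProd-∷ (- t) a L n ⟩
  sumTo n (summand (- t) a L n)                    ≡⟨ sumTo-cong n (λ k _ → summand-neg k) ⟩
  sumTo n (λ k → -1ℤ ^ n * summand t a L n k)      ≡⟨ sumTo-*ˡ n (-1ℤ ^ n) (summand t a L n) ⟩
  -1ℤ ^ n * sumTo n (summand t a L n)              ≡⟨ cong (-1ℤ ^ n *_) (coeffProd-∷ t a L n) ⟨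
  -1ℤ ^ n * coeffProd t (a ∷ L) n                  ∎
  where
  open ≡-Reasoning
  summand-neg : ∀ k → summand (- t) a L n k ≡ -1ℤ ^ n * summand t a L n k
  summand-neg k with k ℕ.* a ≤? n
  ... | no _     = sym (*-zeroʳ (-1ℤ ^ n))
  ... | yes ka≤n = begin
    (- t) ^ k * coeffProd (- t) L r                  ≡⟨ cong₂ _*_ (^-neg t k) (coeffProd-neg t L oddL r) ⟩
    -1ℤ ^ k * t ^ k * (-1ℤ ^ r * coeffProd t L r)    ≡⟨ interchange (-1ℤ ^ k) (t ^ k) (-1ℤ ^ r) _ ⟩
    -1ℤ ^ k * -1ℤ ^ r * (t ^ k * coeffProd t L r)    ≡⟨ cong (_* (t ^ k * coeffProd t L r)) (-1^k*-1^[n∸ka]≡-1^n n k a oa ka≤n) ⟩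
    -1ℤ ^ n * (t ^ k * coeffProd t L r)              ∎
    where r = n ℕ.∸ k ℕ.* a

coeffProd-zero : ∀ t L → coeffProd t L 0 ≡ 1ℤ
coeffProd-zero t []      = refl
coeffProd-zero t (a ∷ L) = begin
  coeffProd t (a ∷ L) 0     ≡⟨ coeffProd-∷ t a L 0 ⟩
  summand t a L 0 0         ≡⟨ summand-≤ t a L 0 0 z≤n ⟩
  1ℤ * coeffProd t L 0      ≡⟨ *-identityˡ (coeffProd t L 0) ⟩
  coeffProd t L 0           ≡⟨ coeffProd-zero t L ⟩
  1ℤ                        ∎
  where open ≡-Reasoning

1^k*i≡i : ∀ k i → 1ℤ ^ k * i ≡ i
1^k*i≡i k i = trans (cong (_* i) (^-zeroˡ k)) (*-identityˡ i)

summand-1-≤ : ∀ a L n k → k ℕ.* a ℕ.≤ n → summand 1ℤ a L n k ≡ coeffProd 1ℤ L (n ℕ.∸ k ℕ.* a)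
summand-1-≤ a L n k ka≤n = trans (summand-≤ 1ℤ a L n k ka≤n) (1^k*i≡i k _)

mutual
  coeffProd-1-nonneg : ∀ L n → 0ℤ ≤ coeffProd 1ℤ L n
  coeffProd-1-nonneg []      zero    = +≤+ z≤n
  coeffProd-1-nonneg []      (suc n) = ≤-refl
  coeffProd-1-nonneg (a ∷ L) n =
    subst (0ℤ ≤_) (sym (coeffProd-∷ 1ℤ a L n)) (sumTo-nonneg n (summand-1-nonneg a L n))

  summand-1-nonneg : ∀ a L n k → 0ℤ ≤ summand 1ℤ a L n k
  summand-1-nonneg a L n k with k ℕ.* a ≤? n
  ... | yes _ = subst (0ℤ ≤_) (sym (1^k*i≡i k _)) (coeffProd-1-nonneg L _)
  ... | no  _ = ≤-refl

1≤coeffProd-multiple : ∀ a L i .{{_ : NonZero a}} → 1ℤ ≤ coeffProd 1ℤ (a ∷ L) (i ℕ.* a)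
1≤coeffProd-multiple a L i = begin
  1ℤ                                ≡⟨ coeffProd-zero 1ℤ L ⟨
  coeffProd 1ℤ L 0                  ≡⟨ cong (coeffProd 1ℤ L) (ℕ.n∸n≡0 n) ⟨
  coeffProd 1ℤ L (n ℕ.∸ n)          ≡⟨ summand-1-≤ a L n i ℕ.≤-refl ⟨
  summand 1ℤ a L n i                ≤⟨ term≤sumTo n (summand-1-nonneg a L n) (ℕ.m≤m*n i a) ⟩
  sumTo n (summand 1ℤ a L n)        ≡⟨ coeffProd-∷ 1ℤ a L n ⟨
  coeffProd 1ℤ (a ∷ L) n            ∎
  where open ≤-Reasoning; n = i ℕ.* a

coeffProd-1∷ : ∀ L n → coeffProd 1ℤ (1 ∷ L) n ≡ sumTo n (λ k → coeffProd 1ℤ L (n ℕ.∸ k))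
coeffProd-1∷ L n = trans (coeffProd-∷ 1ℤ 1 L n) (sumTo-cong n summand≡)
  where
  summand≡ : ∀ k → k ℕ.≤ n → summand 1ℤ 1 L n k ≡ coeffProd 1ℤ L (n ℕ.∸ k)
  summand≡ k k≤n = begin
    summand 1ℤ 1 L n k                 ≡⟨ summand-1-≤ 1 L n k (subst (ℕ._≤ n) (sym k*1≡k) k≤n) ⟩
    coeffProd 1ℤ L (n ℕ.∸ k ℕ.* 1)     ≡⟨ cong (λ x → coeffProd 1ℤ L (n ℕ.∸ x)) k*1≡k ⟩
    coeffProd 1ℤ L (n ℕ.∸ k)           ∎
    where open ≡-Reasoning; k*1≡k = ℕ.*-identityʳ k

coeffProd-1∷-suc : ∀ L n → coeffProd 1ℤ (1 ∷ L) (suc n) ≡ coeffProd 1ℤ L (suc n) + coeffProd 1ℤ (1 ∷ L) n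
coeffProd-1∷-suc L n = begin
  coeffProd 1ℤ (1 ∷ L) (suc n)                                     ≡⟨ coeffProd-1∷ L (suc n) ⟩
  sumTo (suc n) (λ k → coeffProd 1ℤ L (suc n ℕ.∸ k))               ≡⟨ sumTo-sucˡ n _ ⟩
  coeffProd 1ℤ L (suc n) + sumTo n (λ k → coeffProd 1ℤ L (n ℕ.∸ k)) ≡⟨ cong (_+_ (coeffProd 1ℤ L (suc n))) (coeffProd-1∷ L n) ⟨
  coeffProd 1ℤ L (suc n) + coeffProd 1ℤ (1 ∷ L) n                  ∎
  where open ≡-Reasoning

coeffProd-1∷-mono : ∀ L {j n} → j ℕ.≤ n → coeffProd 1ℤ (1 ∷ L) j ≤ coeffProd 1ℤ (1 ∷ L) n
coeffProd-1∷-mono L = mono-from-suc (coeffProd 1ℤ (1 ∷ L)) step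
  where
  step : ∀ n → coeffProd 1ℤ (1 ∷ L) n ≤ coeffProd 1ℤ (1 ∷ L) (suc n)
  step n = subst (coeffProd 1ℤ (1 ∷ L) n ≤_) (sym (coeffProd-1∷-suc L n))
                 (i≤j+i _ _ ⦃ nonNegative (coeffProd-1-nonneg L (suc n)) ⦄)

coeffProd-1∷-growth : ∀ a R i → + suc i ≤ coeffProd 1ℤ (1 ∷ suc a ∷ R) (i ℕ.* suc a)
coeffProd-1∷-growth a R zero    = ≤-reflexive (sym (coeffProd-zero 1ℤ (1 ∷ suc a ∷ R)))
coeffProd-1∷-growth a R (suc i) = begin
  1ℤ + + suc i                                       ≤⟨ +-mono-≤ (1≤coeffProd-multiple (suc a) R (suc i)) IH ⟩
  coeffProd 1ℤ (suc a ∷ R) (suc r) + coeffProd 1ℤ L r ≡⟨ coeffProd-1∷-suc (suc a ∷ R) r ⟨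
  coeffProd 1ℤ L (suc r)                              ∎
  where
  open ≤-Reasoning
  L = 1 ∷ suc a ∷ R
  r = a ℕ.+ i ℕ.* suc a
  IH : + suc i ≤ coeffProd 1ℤ L r
  IH = ≤-trans (coeffProd-1∷-growth a R i) (coeffProd-1∷-mono (suc a ∷ R) (ℕ.m≤n+m _ a))

p-neg : ∀ m → Odd m → ∀ t n → p m n (- t) ≡ -1ℤ ^ n * p m n t
p-neg m m-odd t n = coeffProd-neg t _ (map⁺ (universal (odd-^ m m-odd) (upTo (suc n)))) n

1≤p-1 : ∀ m n → 1ℤ ≤ p m n 1ℤ
1≤p-1 m n = ≤-trans (≤-reflexive (sym (coeffProd-zero 1ℤ (1 ∷ L)))) (coeffProd-1∷-mono L {0} {n} z≤n)
  where L = map (m ℕ.^_) (applyUpTo suc n)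

p-1-growth : ∀ m i n → i ℕ.* suc m ℕ.≤ suc n → + suc i ≤ p (suc m) (suc n) 1ℤ
p-1-growth m i n i[1+m]≤1+n =
  ≤-trans (coeffProd-1∷-growth (m ℕ.* 1) R i) (coeffProd-1∷-mono (suc m ℕ.* 1 ∷ R) i[1+m]≤1+n′)
  where
  R = map (suc m ℕ.^_) (applyUpTo (suc ∘ suc) n)
  i[1+m]≤1+n′ : i ℕ.* suc (m ℕ.* 1) ℕ.≤ suc n
  i[1+m]≤1+n′ = subst (λ x → i ℕ.* suc x ℕ.≤ suc n) (sym (ℕ.*-identityʳ m)) i[1+m]≤1+n

theorem3p6 : (m : ℕ) → m ≥ 3 → m % 2 ≡ 1 →
    ((n : ℕ) → p m n (- (+ 1)) ≡ ((- (+ 1)) ^ n) * p m n (+ 1))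
    × ((B : ℕ) → ∃[ N ] ((n : ℕ) → n ≥ N → B < ∣ p m n (- (+ 1)) ∣))
    × ((n : ℕ) → p m n (- (+ 1)) ≢ + 0)
-- only m ≥ 1 is used
theorem3p6 (suc m) (s≤s _) m-odd = sign , unbounded , nonzero
  where
  sign : ∀ n → p (suc m) n (- 1ℤ) ≡ -1ℤ ^ n * p (suc m) n 1ℤ
  sign = p-neg (suc m) m-odd 1ℤ

  ∣p-neg∣ : ∀ n → ∣ p (suc m) n (- 1ℤ) ∣ ≡ ∣ p (suc m) n 1ℤ ∣
  ∣p-neg∣ n = trans (cong ∣_∣ (sign n)) (∣-1^n*i∣≡∣i∣ n _)

  unbounded : ∀ B → ∃[ N ] (∀ n → n ≥ N → B < ∣ p (suc m) n (- 1ℤ) ∣)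
  unbounded B = suc (B ℕ.* suc m) , λ where
    (suc n) (s≤s B[1+m]≤n) → subst (B <_) (sym (∣p-neg∣ (suc n)))
      (+≤⇒≤∣∣ (p-1-growth m B n (ℕ.m≤n⇒m≤1+n B[1+m]≤n)))

  nonzero : ∀ n → p (suc m) n (- 1ℤ) ≢ 0ℤ
  nonzero n p≡0 = ℕ.n≮0 (subst (λ x → 1 ℕ.≤ ∣ x ∣) p≡0
    (subst (1 ℕ.≤_) (sym (∣p-neg∣ n)) (+≤⇒≤∣∣ (1≤p-1 (suc m) n))))
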